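{- Let $G$ be a connected graph. Let $X$ be a vertex set of $G$ such that $G[X]$ is connected, and let $G-X$ have connected components $G_1,\dots,G_r$ with $n_1,\dots,n_r$ vertices respectively, where $n_1\le n_2\le\dots\le n_r$. Then $\mathrm{ola}^+(G)\ge \mathrm{ola}^+(G[X])+\sum_{i=1}^{r-2}n_i$.
   Context: Graphs are finite, without loops or parallel edges; $G[X]$ is the subgraph induced by $X$. A linear arrangement of $G=(V,E)$ is a bijection $\alpha:V\to\{1,\dots,|V|\}$; net cost $\sum_{uv\in E}(|\alpha(u)-\alpha(v)|-1)$; $\mathrm{ola}^+(G)$ is the minimum net cost. An empty sum is $0$. -}

module Defs where

open import Data.Nat using (ℕ; zero; suc; _+_; _∸_; _≤_; ∣_-_∣; _<ᵇ_)
open import Data.Fin using (Fin; toℕ) renaming (zero to fz; suc to fs; _≟_ to _≟ᶠ_)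
import Data.Fin as F
open import Data.Bool using (Bool; true; false; if_then_else_; _∧_)
open import Data.Vec using (Vec; []; _∷_)
open import Data.Fin.Subset using (Subset; _∈_; _∉_)
open import Data.Fin.Subset.Properties using (_∈?_)
open import Data.Unit using (⊤)
open import Data.Product using (Σ; ∃; _×_; _,_)
open import Relation.Nullary using (yes; no; ¬_)
open import Relation.Nullary.Decidable using (⌊_⌋)
open import Relation.Binary.PropositionalEquality using (_≡_; refl)
open import Function.Definitions using (Bijective)

record Graph : Set where
  field
    n      : ℕ
    adj    : Fin n → Fin n → Bool
    sym    : ∀ u v → adj u v ≡ adj v u
    irrefl : ∀ v → adj v v ≡ false
open Graph public

sumFin : (n : ℕ) → (Fin n → ℕ) → ℕ
sumFin zero    f = 0
sumFin (suc n) f = f fz + sumFin n (λ i → f (fs i))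

data Walk (G : Graph) (P : Fin (n G) → Set) : Fin (n G) → Fin (n G) → Set where
  here : ∀ {v} → P v → Walk G P v v
  step : ∀ {u w v} → P u → adj G u w ≡ true → Walk G P w v → Walk G P u v

Connected : Graph → Set
Connected G = ∀ u v → Walk G (λ _ → ⊤) u v

-- Induced subgraph G[X]: the vertices of X enumerated in increasing order.
card : ∀ {m} → Subset m → ℕ
card []          = 0
card (true ∷ X)  = suc (card X)
card (false ∷ X) = card X

embed : ∀ {m} (X : Subset m) → Fin (card X) → Fin m
embed (true ∷ X)  fz     = fz
embed (true ∷ X)  (fs i) = fs (embed X i)
embed (false ∷ X) i      = fs (embed X i)

induced : (G : Graph) → Subset (n G) → Graph
induced G X = record
  { n      = card X
  ; adj    = λ i j → adj G (embed X i) (embed X j)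
  ; sym    = λ i j → sym G (embed X i) (embed X j)
  ; irrefl = λ i → irrefl G (embed X i)
  }

-- Linear arrangements (0-based positions; net cost is translation invariant).
Arrangement : Graph → Set
Arrangement G = Σ (Fin (n G) → Fin (n G)) λ α → Bijective _≡_ _≡_ α

netCost : (G : Graph) → (Fin (n G) → Fin (n G)) → ℕ
netCost G α =
  sumFin (n G) λ u → sumFin (n G) λ v →
    if (toℕ u <ᵇ toℕ v) ∧ adj G u v
    then ∣ toℕ (α u) - toℕ (α v) ∣ ∸ 1
    else 0

IsOla⁺ : Graph → ℕ → Set
IsOla⁺ G m = (∃ λ (a : Arrangement G) → netCost G (Data.Product.proj₁ a) ≡ m)
           × (∀ (a : Arrangement G) → m ≤ netCost G (Data.Product.proj₁ a))

IsComponentLabelling : (G : Graph) (X : Subset (n G)) (r : ℕ)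
  → ((v : Fin (n G)) → v ∉ X → Fin r) → Set
IsComponentLabelling G X r comp =
    (∀ (i : Fin r) → ∃ λ v → Σ (v ∉ X) λ h → comp v h ≡ i)
  × (∀ u v (hu : u ∉ X) (hv : v ∉ X) →
       (comp u hu ≡ comp v hv → Walk G (λ w → w ∉ X) u v)
     × (Walk G (λ w → w ∉ X) u v → comp u hu ≡ comp v hv))

compSize : (G : Graph) (X : Subset (n G)) (r : ℕ)
  → ((v : Fin (n G)) → v ∉ X → Fin r) → Fin r → ℕ
compSize G X r comp i = sumFin (n G) f
  where
  f : Fin (n G) → ℕ
  f v with v ∈? X
  ... | yes _ = 0
  ... | no h  = if ⌊ comp v h ≟ᶠ i ⌋ then 1 else 0

-- Σ_{i=1}^{r-2} s_i  (0-based: indices i with i + 2 < r)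
sumButTwoLast : (r : ℕ) → (Fin r → ℕ) → ℕ
sumButTwoLast r s = sumFin r λ i → if toℕ i + 2 <ᵇ r then s i else 0

-- Fix an optimal arrangement α of G and let the load of a vertex w be the number of edges uv with α(w)
-- strictly between α(u) and α(v); the net cost of α is the total load. Ranking the vertices of X by
-- their α-positions arranges G[X] with net cost at most the load carried by X, so that load is at least
-- ola⁺(G[X]). Outside X, two load-free vertices a, b on the same side of some x₀ ∈ X, with b between a
-- and x₀, lie in one component of G − X: a walk from a to x₀ can neither jump over b nor enter X before
-- reaching b, since the connected G[X] would then have an edge over b. Hence the load-free vertices
-- outside X meet at most two components, every other vertex outside X carries load at least 1, and the
-- load outside X is at least the total size of all components but the two largest.

module Submission where

open import Defs hiding (sym)
open import Data.Nat using (ℕ; zero; suc; _+_; _∸_; _≤_; _<_; _>_; ∣_-_∣; _<ᵇ_; z≤n; s≤s; s≤s⁻¹; z<s)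
open import Data.Fin using (Fin; toℕ; fromℕ; fromℕ<; inject₁; punchOut)
  renaming (zero to fz; suc to fs; _≟_ to _≟ᶠ_)
import Data.Fin
open import Data.Fin.Subset using (Subset; _∈_; _∉_)
open import Data.Nat.Properties
open import Algebra.Properties.Semiring.Sum +-*-semiring using (sum; sum-cong-≗; ∑-distrib-+; ∑-comm; sum-permute)
open import Algebra.Properties.CommutativeSemigroup +-commutativeSemigroup using (x∙yz≈y∙xz)
open import Data.Bool using (Bool; true; false; if_then_else_; _∧_)
open import Data.Bool.Properties using (T-≡)
open import Data.Fin.Properties as Finₚ using (toℕ-injective; toℕ-fromℕ<; punchOut-injective; injective⇒≤)
open import Data.Fin.Subset.Properties using (_∈?_; nonempty?)
open import Data.Vec using ([]; _∷_; lookup; here; there)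
open import Data.Vec.Properties using (lookup⇒[]=)
open import Data.Product using (Σ; ∃; ∃₂; _×_; _,_; proj₁; proj₂)
open import Data.Sum using (_⊎_; inj₁; inj₂; [_,_]′)
open import Data.Empty using (⊥; ⊥-elim)
open import Data.Unit using (⊤)
open import Function.Base using (_∘_)
open import Function.Bundles using (Equivalence; mk⤖)
open import Function.Definitions using (Bijective; Injective; Surjective)
open import Function.Properties.Bijection using (⤖⇒↔)
open import Relation.Nullary using (Dec; yes; no; ¬?; _×-dec_)
open import Relation.Nullary.Decidable using (⌊_⌋)
open import Relation.Binary.Consequences using (tri⇒asym; tri⇒dec<)
import Relation.Binary.Construct.Flip.EqAndOrd as Flip
open import Relation.Binary.Structures using (IsStrictTotalOrder)
open import Relation.Binary.Definitions using (Trichotomous; tri<; tri≈; tri>)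
open import Relation.Binary.PropositionalEquality

sumFin≡sum : ∀ n (f : Fin n → ℕ) → sumFin n f ≡ sum f
sumFin≡sum zero    f = refl
sumFin≡sum (suc n) f = cong (f fz +_) (sumFin≡sum n (λ i → f (fs i)))

sumFin-cong : ∀ n {f g : Fin n → ℕ} → (∀ i → f i ≡ g i) → sumFin n f ≡ sumFin n g
sumFin-cong n {f} {g} f≗g = begin
  sumFin n f ≡⟨ sumFin≡sum n f ⟩
  sum f      ≡⟨ sum-cong-≗ f≗g ⟩
  sum g      ≡⟨ sumFin≡sum n g ⟨
  sumFin n g ∎
  where open ≡-Reasoning

sumFin-mono-≤ : ∀ n {f g : Fin n → ℕ} → (∀ i → f i ≤ g i) → sumFin n f ≤ sumFin n g
sumFin-mono-≤ zero    f≤g = z≤n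
sumFin-mono-≤ (suc n) f≤g = +-mono-≤ (f≤g fz) (sumFin-mono-≤ n (λ i → f≤g (fs i)))

sumFin-distrib-+ : ∀ n (f g : Fin n → ℕ) → sumFin n (λ i → f i + g i) ≡ sumFin n f + sumFin n g
sumFin-distrib-+ n f g = begin
  sumFin n (λ i → f i + g i) ≡⟨ sumFin≡sum n _ ⟩
  sum (λ i → f i + g i)      ≡⟨ ∑-distrib-+ f g ⟩
  sum f + sum g              ≡⟨ cong₂ _+_ (sumFin≡sum n f) (sumFin≡sum n g) ⟨
  sumFin n f + sumFin n g    ∎
  where open ≡-Reasoning

sumFin-comm : ∀ m n (f : Fin m → Fin n → ℕ) →
              sumFin m (λ i → sumFin n (f i)) ≡ sumFin n (λ j → sumFin m (λ i → f i j))
sumFin-comm m n f = begin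
  sumFin m (λ i → sumFin n (f i))           ≡⟨ sumFin-cong m (λ i → sumFin≡sum n (f i)) ⟩
  sumFin m (λ i → sum (f i))                ≡⟨ sumFin≡sum m _ ⟩
  sum (λ i → sum (f i))                     ≡⟨ ∑-comm f ⟩
  sum (λ j → sum (λ i → f i j))             ≡⟨ sumFin≡sum n _ ⟨
  sumFin n (λ j → sum (λ i → f i j))        ≡⟨ sumFin-cong n (λ j → sumFin≡sum m (λ i → f i j)) ⟨
  sumFin n (λ j → sumFin m (λ i → f i j))   ∎
  where open ≡-Reasoning

sumFin-reindex : ∀ n {α : Fin n → Fin n} → Bijective _≡_ _≡_ α → (f : Fin n → ℕ) →
                 sumFin n (λ i → f (α i)) ≡ sumFin n f
sumFin-reindex n {α} α-bij f = begin
  sumFin n (λ i → f (α i)) ≡⟨ sumFin≡sum n _ ⟩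
  sum (λ i → f (α i))      ≡⟨ sum-permute f (⤖⇒↔ (mk⤖ α-bij)) ⟨
  sum f                    ≡⟨ sumFin≡sum n f ⟨
  sumFin n f               ∎
  where open ≡-Reasoning

sumFin-zeros : ∀ n → sumFin n (λ _ → 0) ≡ 0
sumFin-zeros zero    = refl
sumFin-zeros (suc n) = sumFin-zeros n

sumFin-ones : ∀ n → sumFin n (λ _ → 1) ≡ n
sumFin-ones zero    = refl
sumFin-ones (suc n) = cong suc (sumFin-ones n)

term≤sumFin : ∀ n (f : Fin n → ℕ) i → f i ≤ sumFin n f
term≤sumFin (suc n) f fz     = m≤m+n (f fz) _
term≤sumFin (suc n) f (fs i) = ≤-trans (term≤sumFin n (λ j → f (fs j)) i) (m≤n+m _ (f fz))

sumFin-single : ∀ n (i : Fin n) {f : Fin n → ℕ} → (∀ j → j ≢ i → f j ≡ 0) → sumFin n f ≡ f i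
sumFin-single (suc n) fz     {f} f≡0 = begin
  f fz + sumFin n (λ j → f (fs j)) ≡⟨ cong (f fz +_) (sumFin-cong n (λ j → f≡0 (fs j) λ ()) ) ⟩
  f fz + sumFin n (λ _ → 0)        ≡⟨ cong (f fz +_) (sumFin-zeros n) ⟩
  f fz + 0                         ≡⟨ +-identityʳ (f fz) ⟩
  f fz                             ∎
  where open ≡-Reasoning
sumFin-single (suc n) (fs i) {f} f≡0 =
  cong₂ _+_ (f≡0 fz λ ()) (sumFin-single n i (λ j j≢i → f≡0 (fs j) (j≢i ∘ Finₚ.suc-injective)))

if-then-sumFin : ∀ n b (f : Fin n → ℕ) →
                 (if b then sumFin n f else 0) ≡ sumFin n (λ i → if b then f i else 0)
if-then-sumFin n true  f = refl
if-then-sumFin n false f = sym (sumFin-zeros n)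

if-then-mono-≤ : ∀ b {x y} → x ≤ y → (if b then x else 0) ≤ (if b then y else 0)
if-then-mono-≤ true  x≤y = x≤y
if-then-mono-≤ false x≤y = z≤n

𝟙[_,_⟩ : ℕ → ℕ → ℕ → ℕ
𝟙[ lo     , zero   ⟩ z       = 0
𝟙[ zero   , suc hi ⟩ zero    = 1
𝟙[ zero   , suc hi ⟩ (suc z) = 𝟙[ zero , hi ⟩ z
𝟙[ suc lo , suc hi ⟩ zero    = 0
𝟙[ suc lo , suc hi ⟩ (suc z) = 𝟙[ lo , hi ⟩ z

𝟙≤1 : ∀ lo hi z → 𝟙[ lo , hi ⟩ z ≤ 1
𝟙≤1 lo       zero     z       = z≤n
𝟙≤1 zero     (suc hi) zero    = ≤-refl
𝟙≤1 zero     (suc hi) (suc z) = 𝟙≤1 zero hi z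
𝟙≤1 (suc lo) (suc hi) zero    = z≤n
𝟙≤1 (suc lo) (suc hi) (suc z) = 𝟙≤1 lo hi z

𝟙-inside : ∀ {lo hi z} → lo ≤ z → z < hi → 𝟙[ lo , hi ⟩ z ≡ 1
𝟙-inside {zero}   {suc hi} {zero}  z≤n       (s≤s z<hi) = refl
𝟙-inside {zero}   {suc hi} {suc z} z≤n       (s≤s z<hi) = 𝟙-inside z≤n z<hi
𝟙-inside {suc lo} {suc hi} {suc z} (s≤s lo≤z) (s≤s z<hi) = 𝟙-inside lo≤z z<hi

𝟙-singleton-≢ : ∀ {y z} → z ≢ y → 𝟙[ y , suc y ⟩ z ≡ 0
𝟙-singleton-≢ {zero}  {zero}  z≢y = ⊥-elim (z≢y refl)
𝟙-singleton-≢ {zero}  {suc z} z≢y = refl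
𝟙-singleton-≢ {suc y} {zero}  z≢y = refl
𝟙-singleton-≢ {suc y} {suc z} z≢y = 𝟙-singleton-≢ (z≢y ∘ cong suc)

𝟙-split : ∀ {lo mid hi} z → lo ≤ mid → mid ≤ hi → 𝟙[ lo , hi ⟩ z ≡ 𝟙[ lo , mid ⟩ z + 𝟙[ mid , hi ⟩ z
𝟙-split {zero}   {zero}    {zero}   z       z≤n         z≤n          = refl
𝟙-split {zero}   {zero}    {suc hi} z       z≤n         z≤n          = refl
𝟙-split {zero}   {suc mid} {suc hi} zero    z≤n         (s≤s mid≤hi) = refl
𝟙-split {zero}   {suc mid} {suc hi} (suc z) z≤n         (s≤s mid≤hi) = 𝟙-split z z≤n mid≤hi
𝟙-split {suc lo} {suc mid} {suc hi} zero    (s≤s lo≤mid) (s≤s mid≤hi) = refl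
𝟙-split {suc lo} {suc mid} {suc hi} (suc z) (s≤s lo≤mid) (s≤s mid≤hi) = 𝟙-split z lo≤mid mid≤hi

∑𝟙≤length : ∀ n lo hi → sumFin n (λ i → 𝟙[ lo , hi ⟩ (toℕ i)) ≤ hi ∸ lo
∑𝟙≤length zero    lo       hi       = z≤n
∑𝟙≤length (suc n) lo       zero     = ≤-trans (≤-reflexive (sumFin-zeros (suc n))) z≤n
∑𝟙≤length (suc n) zero     (suc hi) = s≤s (∑𝟙≤length n zero hi)
∑𝟙≤length (suc n) (suc lo) (suc hi) = ∑𝟙≤length n lo hi

between : ℕ → ℕ → ℕ → ℕ
between x y z = 𝟙[ suc x , y ⟩ z + 𝟙[ suc y , x ⟩ z

between-comm : ∀ x y z → between x y z ≡ between y x z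
between-comm x y z = +-comm (𝟙[ suc x , y ⟩ z) _

between≥1 : ∀ {x y z} → x < z → z < y → 1 ≤ between x y z
between≥1 {x} {y} {z} x<z z<y = ≤-trans (≤-reflexive (sym (𝟙-inside x<z z<y))) (m≤m+n _ _)

∸-suc-+-∸-suc : ∀ x y → (y ∸ suc x) + (x ∸ suc y) ≡ ∣ x - y ∣ ∸ 1
∸-suc-+-∸-suc zero    zero    = refl
∸-suc-+-∸-suc zero    (suc y) = +-identityʳ y
∸-suc-+-∸-suc (suc x) zero    = refl
∸-suc-+-∸-suc (suc x) (suc y) = ∸-suc-+-∸-suc x y

∑between≤∣-∣∸1 : ∀ n {α : Fin n → Fin n} → Bijective _≡_ _≡_ α → ∀ x y →
               sumFin n (λ i → between x y (toℕ (α i))) ≤ ∣ x - y ∣ ∸ 1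
∑between≤∣-∣∸1 n {α} α-bij x y = begin
  sumFin n (λ i → between x y (toℕ (α i)))
    ≡⟨ sumFin-reindex n α-bij (λ i → between x y (toℕ i)) ⟩
  sumFin n (λ i → between x y (toℕ i))
    ≡⟨ sumFin-distrib-+ n _ _ ⟩
  sumFin n (λ i → 𝟙[ suc x , y ⟩ (toℕ i)) + sumFin n (λ i → 𝟙[ suc y , x ⟩ (toℕ i))
    ≤⟨ +-mono-≤ (∑𝟙≤length n (suc x) y) (∑𝟙≤length n (suc y) x) ⟩
  (y ∸ suc x) + (x ∸ suc y)
    ≡⟨ ∸-suc-+-∸-suc x y ⟩
  ∣ x - y ∣ ∸ 1 ∎
  where open ≤-Reasoning

injective⇒surjective : ∀ {n} {f : Fin n → Fin n} → Injective _≡_ _≡_ f → Surjective _≡_ _≡_ f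
injective⇒surjective {suc n} {f} f-inj y with Finₚ.any? (λ x → f x ≟ᶠ y)
... | yes (x , fx≡y) = x , λ { refl → fx≡y }
... | no ∄x = ⊥-elim (1+n≰n (injective⇒≤ punchOut∘f-injective))
  where
  y≢f : ∀ x → y ≢ f x
  y≢f x y≡fx = ∄x (x , sym y≡fx)
  punchOut∘f : Fin (suc n) → Fin n
  punchOut∘f x = punchOut (y≢f x)
  punchOut∘f-injective : Injective _≡_ _≡_ punchOut∘f
  punchOut∘f-injective {x} {x′} eq = f-inj (punchOut-injective (y≢f x) (y≢f x′) eq)

module Rank {m} (c : Fin m → ℕ) (c-injective : Injective _≡_ _≡_ c) where

  rank : Fin m → ℕ
  rank i = sumFin m (λ k → 𝟙[ 0 , c i ⟩ (c k))

  strictlyBetween : Fin m → Fin m → ℕ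
  strictlyBetween i j = sumFin m (λ k → 𝟙[ suc (c i) , c j ⟩ (c k))

  ∑𝟙-at-c≡1 : ∀ i → sumFin m (λ k → 𝟙[ c i , suc (c i) ⟩ (c k)) ≡ 1
  ∑𝟙-at-c≡1 i = trans (sumFin-single m i (λ k k≢i → 𝟙-singleton-≢ (k≢i ∘ c-injective)))
                      (𝟙-inside {c i} ≤-refl ≤-refl)

  rank-step : ∀ {i j} → c i < c j → rank j ≡ rank i + suc (strictlyBetween i j)
  rank-step {i} {j} ci<cj = begin
    rank j
      ≡⟨ sumFin-cong m (λ k → 𝟙-split (c k) z≤n (<⇒≤ ci<cj)) ⟩
    sumFin m (λ k → 𝟙[ 0 , c i ⟩ (c k) + 𝟙[ c i , c j ⟩ (c k))
      ≡⟨ sumFin-distrib-+ m _ _ ⟩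
    rank i + sumFin m (λ k → 𝟙[ c i , c j ⟩ (c k))
      ≡⟨ cong (rank i +_) (sumFin-cong m (λ k → 𝟙-split (c k) (n≤1+n (c i)) ci<cj)) ⟩
    rank i + sumFin m (λ k → 𝟙[ c i , suc (c i) ⟩ (c k) + 𝟙[ suc (c i) , c j ⟩ (c k))
      ≡⟨ cong (rank i +_) (sumFin-distrib-+ m _ _) ⟩
    rank i + (sumFin m (λ k → 𝟙[ c i , suc (c i) ⟩ (c k)) + strictlyBetween i j)
      ≡⟨ cong (λ one → rank i + (one + strictlyBetween i j)) (∑𝟙-at-c≡1 i) ⟩
    rank i + suc (strictlyBetween i j) ∎
    where open ≡-Reasoning

  rank-mono-< : ∀ {i j} → c i < c j → rank i < rank j
  rank-mono-< {i} {j} ci<cj = subst (rank i <_) (sym (rank-step ci<cj)) (m<m+n (rank i) z<s)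

  rank<m : ∀ i → rank i < m
  rank<m i = begin-strict
    rank i
      <⟨ m<m+n (rank i) z<s ⟩
    rank i + 1
      ≡⟨ cong (rank i +_) (∑𝟙-at-c≡1 i) ⟨
    rank i + sumFin m (λ k → 𝟙[ c i , suc (c i) ⟩ (c k))
      ≡⟨ sumFin-distrib-+ m _ _ ⟨
    sumFin m (λ k → 𝟙[ 0 , c i ⟩ (c k) + 𝟙[ c i , suc (c i) ⟩ (c k))
      ≡⟨ sumFin-cong m (λ k → 𝟙-split (c k) z≤n (n≤1+n (c i))) ⟨
    sumFin m (λ k → 𝟙[ 0 , suc (c i) ⟩ (c k))
      ≤⟨ sumFin-mono-≤ m (λ k → 𝟙≤1 0 (suc (c i)) (c k)) ⟩
    sumFin m (λ _ → 1)
      ≡⟨ sumFin-ones m ⟩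
    m ∎
    where open ≤-Reasoning

  rankFin : Fin m → Fin m
  rankFin i = fromℕ< (rank<m i)

  toℕ-rankFin : ∀ i → toℕ (rankFin i) ≡ rank i
  toℕ-rankFin i = toℕ-fromℕ< (rank<m i)

  rankFin-injective : Injective _≡_ _≡_ rankFin
  rankFin-injective {i} {j} eq with <-cmp (c i) (c j)
  ... | tri< ci<cj _ _ = ⊥-elim (<-irrefl rank-i≡rank-j (rank-mono-< ci<cj))
    where
    rank-i≡rank-j : rank i ≡ rank j
    rank-i≡rank-j = trans (sym (toℕ-rankFin i)) (trans (cong toℕ eq) (toℕ-rankFin j))
  ... | tri≈ _ ci≡cj _ = c-injective ci≡cj
  ... | tri> _ _ cj<ci = ⊥-elim (<-irrefl rank-j≡rank-i (rank-mono-< cj<ci))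
    where
    rank-j≡rank-i : rank j ≡ rank i
    rank-j≡rank-i = trans (sym (toℕ-rankFin j)) (trans (cong toℕ (sym eq)) (toℕ-rankFin i))

  rankFin-bijective : Bijective _≡_ _≡_ rankFin
  rankFin-bijective = rankFin-injective , injective⇒surjective rankFin-injective

  private
    rank-distance≤∑between-< : ∀ {i j} → c i < c j →
                               ∣ rank i - rank j ∣ ∸ 1 ≤ sumFin m (λ k → between (c i) (c j) (c k))
    rank-distance≤∑between-< {i} {j} ci<cj = begin
      ∣ rank i - rank j ∣ ∸ 1
        ≡⟨ cong (λ r → ∣ rank i - r ∣ ∸ 1) (rank-step ci<cj) ⟩
      ∣ rank i - rank i + suc (strictlyBetween i j) ∣ ∸ 1
        ≡⟨ cong (_∸ 1) (∣m-m+n∣≡n (rank i) _) ⟩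
      strictlyBetween i j
        ≤⟨ sumFin-mono-≤ m (λ k → m≤m+n _ _) ⟩
      sumFin m (λ k → between (c i) (c j) (c k)) ∎
      where open ≤-Reasoning

  rank-distance≤∑between : ∀ i j →
    ∣ toℕ (rankFin i) - toℕ (rankFin j) ∣ ∸ 1 ≤ sumFin m (λ k → between (c i) (c j) (c k))
  rank-distance≤∑between i j rewrite toℕ-rankFin i | toℕ-rankFin j with <-cmp (c i) (c j)
  ... | tri< ci<cj _ _ = rank-distance≤∑between-< ci<cj
  ... | tri≈ _ ci≡cj _ rewrite c-injective ci≡cj | ∣n-n∣≡0 (rank j) = z≤n
  ... | tri> _ _ cj<ci = begin
    ∣ rank i - rank j ∣ ∸ 1                     ≡⟨ cong (_∸ 1) (∣-∣-comm (rank i) (rank j)) ⟩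
    ∣ rank j - rank i ∣ ∸ 1                     ≤⟨ rank-distance≤∑between-< cj<ci ⟩
    sumFin m (λ k → between (c j) (c i) (c k)) ≡⟨ sumFin-cong m (λ k → between-comm (c j) (c i) (c k)) ⟩
    sumFin m (λ k → between (c i) (c j) (c k)) ∎
    where open ≤-Reasoning

orderedEdge : (G : Graph) → Fin (n G) → Fin (n G) → Bool
orderedEdge G u v = (toℕ u <ᵇ toℕ v) ∧ adj G u v

load : (G : Graph) → (Fin (n G) → ℕ) → Fin (n G) → ℕ
load G p w = sumFin (n G) λ u → sumFin (n G) λ v →
  if orderedEdge G u v then between (p u) (p v) (p w) else 0

module _ (G : Graph) where

  private
    N : ℕ
    N = n G

  ∑load≡∑edges∑between : ∀ p → sumFin N (load G p) ≡
    sumFin N (λ u → sumFin N (λ v → if orderedEdge G u v then sumFin N (λ w → between (p u) (p v) (p w)) else 0))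
  ∑load≡∑edges∑between p = begin
    sumFin N (λ w → sumFin N (λ u → sumFin N (λ v → term u v w)))
      ≡⟨ sumFin-comm N N (λ w u → sumFin N (λ v → term u v w)) ⟩
    sumFin N (λ u → sumFin N (λ w → sumFin N (λ v → term u v w)))
      ≡⟨ sumFin-cong N (λ u → sumFin-comm N N (λ w v → term u v w)) ⟩
    sumFin N (λ u → sumFin N (λ v → sumFin N (λ w → term u v w)))
      ≡⟨ sumFin-cong N (λ u → sumFin-cong N (λ v → if-then-sumFin N (orderedEdge G u v) _)) ⟨
    sumFin N (λ u → sumFin N (λ v → if orderedEdge G u v then sumFin N (λ w → between (p u) (p v) (p w)) else 0)) ∎
    where
    open ≡-Reasoning
    term : Fin N → Fin N → Fin N → ℕ
    term u v w = if orderedEdge G u v then between (p u) (p v) (p w) else 0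

  ∑load≤netCost : ∀ {α} → Bijective _≡_ _≡_ α → sumFin N (load G (λ u → toℕ (α u))) ≤ netCost G α
  ∑load≤netCost {α} α-bij = begin
    sumFin N (load G (λ u → toℕ (α u)))
      ≡⟨ ∑load≡∑edges∑between (λ u → toℕ (α u)) ⟩
    sumFin N (λ u → sumFin N (λ v →
      if orderedEdge G u v then sumFin N (λ w → between (toℕ (α u)) (toℕ (α v)) (toℕ (α w))) else 0))
      ≤⟨ sumFin-mono-≤ N (λ u → sumFin-mono-≤ N (λ v →
           if-then-mono-≤ (orderedEdge G u v) (∑between≤∣-∣∸1 N α-bij (toℕ (α u)) (toℕ (α v))))) ⟩
    netCost G α ∎
    where open ≤-Reasoning

  netCost-rankFin≤∑load : ∀ {c} (c-injective : Injective _≡_ _≡_ c) →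
                          netCost G (Rank.rankFin c c-injective) ≤ sumFin N (load G c)
  netCost-rankFin≤∑load {c} c-injective = begin
    netCost G (rankFin)
      ≤⟨ sumFin-mono-≤ N (λ u → sumFin-mono-≤ N (λ v →
           if-then-mono-≤ (orderedEdge G u v) (rank-distance≤∑between u v))) ⟩
    sumFin N (λ u → sumFin N (λ v → if orderedEdge G u v then sumFin N (λ w → between (c u) (c v) (c w)) else 0))
      ≡⟨ ∑load≡∑edges∑between c ⟨
    sumFin N (load G c) ∎
    where
    open ≤-Reasoning
    open Rank c c-injective

outside : ∀ {N} → Subset N → (Fin N → ℕ) → Fin N → ℕ
outside X f w = if lookup X w then 0 else f w

sumFin-split-embed : ∀ {N} (X : Subset N) (f : Fin N → ℕ) →
                     sumFin N f ≡ sumFin (card X) (λ i → f (embed X i)) + sumFin N (outside X f)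
sumFin-split-embed []          f = refl
sumFin-split-embed (true ∷ X)  f = begin
  f fz + sumFin _ (λ w → f (fs w))
    ≡⟨ cong (f fz +_) (sumFin-split-embed X (λ w → f (fs w))) ⟩
  f fz + (sumFin (card X) (λ i → f (fs (embed X i))) + sumFin _ (outside X (λ w → f (fs w))))
    ≡⟨ +-assoc (f fz) _ _ ⟨
  f fz + sumFin (card X) (λ i → f (fs (embed X i))) + sumFin _ (outside X (λ w → f (fs w))) ∎
  where open ≡-Reasoning
sumFin-split-embed (false ∷ X) f = begin
  f fz + sumFin _ (λ w → f (fs w))
    ≡⟨ cong (f fz +_) (sumFin-split-embed X (λ w → f (fs w))) ⟩
  f fz + (sumFin (card X) (λ i → f (fs (embed X i))) + sumFin _ (outside X (λ w → f (fs w))))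
    ≡⟨ x∙yz≈y∙xz (f fz) (sumFin (card X) (λ i → f (fs (embed X i)))) _ ⟩
  sumFin (card X) (λ i → f (fs (embed X i))) + (f fz + sumFin _ (outside X (λ w → f (fs w)))) ∎
  where open ≡-Reasoning

sumFin-embed-≤ : ∀ {N} (X : Subset N) (f : Fin N → ℕ) → sumFin (card X) (λ i → f (embed X i)) ≤ sumFin N f
sumFin-embed-≤ []          f = z≤n
sumFin-embed-≤ (true ∷ X)  f = +-monoʳ-≤ (f fz) (sumFin-embed-≤ X (λ w → f (fs w)))
sumFin-embed-≤ (false ∷ X) f = ≤-trans (sumFin-embed-≤ X (λ w → f (fs w))) (m≤n+m _ (f fz))

embed-<ᵇ : ∀ {N} (X : Subset N) i j → (toℕ (embed X i) <ᵇ toℕ (embed X j)) ≡ (toℕ i <ᵇ toℕ j)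
embed-<ᵇ (true ∷ X)  fz     fz     = refl
embed-<ᵇ (true ∷ X)  fz     (fs j) = refl
embed-<ᵇ (true ∷ X)  (fs i) fz     = refl
embed-<ᵇ (true ∷ X)  (fs i) (fs j) = embed-<ᵇ X i j
embed-<ᵇ (false ∷ X) i      j      = embed-<ᵇ X i j

embed-injective : ∀ {N} (X : Subset N) → Injective _≡_ _≡_ (embed X)
embed-injective (true ∷ X)  {fz}   {fz}   eq = refl
embed-injective (true ∷ X)  {fs i} {fs j} eq = cong fs (embed-injective X (Finₚ.suc-injective eq))
embed-injective (false ∷ X)               eq = embed-injective X (Finₚ.suc-injective eq)

embed-∈ : ∀ {N} (X : Subset N) i → embed X i ∈ X
embed-∈ (true ∷ X)  fz     = here
embed-∈ (true ∷ X)  (fs i) = there (embed-∈ X i)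
embed-∈ (false ∷ X) i      = there (embed-∈ X i)

∈⇒embed : ∀ {N} {X : Subset N} {u} → u ∈ X → ∃ λ i → embed X i ≡ u
∈⇒embed here = fz , refl
∈⇒embed {X = true ∷ X}  (there u∈X) = let i , eq = ∈⇒embed u∈X in fs i , cong fs eq
∈⇒embed {X = false ∷ X} (there u∈X) = let i , eq = ∈⇒embed u∈X in i , cong fs eq

orderedEdge-induced : ∀ G X i j → orderedEdge (induced G X) i j ≡ orderedEdge G (embed X i) (embed X j)
orderedEdge-induced G X i j = cong (_∧ adj G (embed X i) (embed X j)) (sym (embed-<ᵇ X i j))

load-induced≤ : ∀ G X (p : Fin (n G) → ℕ) k →
                load (induced G X) (λ i → p (embed X i)) k ≤ load G p (embed X k)
load-induced≤ G X p k = begin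
  load (induced G X) (λ i → p (embed X i)) k
    ≡⟨ sumFin-cong (card X) (λ i → sumFin-cong (card X) (λ j →
         cong (λ b → if b then between (p (embed X i)) (p (embed X j)) (p (embed X k)) else 0)
              (orderedEdge-induced G X i j))) ⟩
  sumFin (card X) (λ i → sumFin (card X) (λ j → term (embed X i) (embed X j)))
    ≤⟨ sumFin-mono-≤ (card X) (λ i → sumFin-embed-≤ X (term (embed X i))) ⟩
  sumFin (card X) (λ i → sumFin (n G) (term (embed X i)))
    ≤⟨ sumFin-embed-≤ X (λ u → sumFin (n G) (term u)) ⟩
  load G p (embed X k) ∎
  where
  open ≤-Reasoning
  term : Fin (n G) → Fin (n G) → ℕ
  term u v = if orderedEdge G u v then between (p u) (p v) (p (embed X k)) else 0

Uncovered : (G : Graph) → (ℕ → ℕ → Set) → (Fin (n G) → ℕ) → Fin (n G) → Set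
Uncovered G _≺_ p w = ∀ {u v} → adj G u v ≡ true → p u ≺ p w → p w ≺ p v → ⊥

module _ (G : Graph) (p : Fin (n G) → ℕ) where

  between≤load : ∀ {u v} w → toℕ u < toℕ v → adj G u v ≡ true → between (p u) (p v) (p w) ≤ load G p w
  between≤load {u} {v} w u<v uv = begin
    between (p u) (p v) (p w) ≡⟨ term≡ ⟩
    term u v                  ≤⟨ term≤sumFin (n G) (term u) v ⟩
    sumFin (n G) (term u)     ≤⟨ term≤sumFin (n G) (λ u′ → sumFin (n G) (term u′)) u ⟩
    load G p w                ∎
    where
    open ≤-Reasoning
    term : Fin (n G) → Fin (n G) → ℕ
    term u′ v′ = if orderedEdge G u′ v′ then between (p u′) (p v′) (p w) else 0
    term≡ : between (p u) (p v) (p w) ≡ term u v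
    term≡ rewrite Equivalence.to T-≡ (<⇒<ᵇ u<v) | uv = refl

  load≡0⇒uncovered : ∀ {w} → load G p w ≡ 0 → Uncovered G _<_ p w
  load≡0⇒uncovered {w} load≡0 {u} {v} uv pu<pw pw<pv with <-cmp (toℕ u) (toℕ v)
  ... | tri< u<v _ _ = n≮0 (begin
    1                          ≤⟨ between≥1 pu<pw pw<pv ⟩
    between (p u) (p v) (p w) ≤⟨ between≤load w u<v uv ⟩
    load G p w                 ≡⟨ load≡0 ⟩
    0 ∎)
    where open ≤-Reasoning
  ... | tri≈ _ u≡v _ with refl ← toℕ-injective u≡v = <-asym pu<pw pw<pv
  ... | tri> _ _ v<u = n≮0 (begin
    1                          ≤⟨ between≥1 pu<pw pw<pv ⟩
    between (p u) (p v) (p w) ≡⟨ between-comm (p u) (p v) (p w) ⟩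
    between (p v) (p u) (p w) ≤⟨ between≤load w v<u (trans (Graph.sym G v u) uv) ⟩
    load G p w                 ≡⟨ load≡0 ⟩
    0 ∎)
    where open ≤-Reasoning

  uncovered-flip : ∀ {w} → Uncovered G _<_ p w → Uncovered G _>_ p w
  uncovered-flip uncovered uv pw<pu pv<pw = uncovered (trans (Graph.sym G _ _) uv) pv<pw pw<pu

Walk-map : ∀ {G P Q} → (∀ {x} → P x → Q x) → ∀ {u v} → Walk G P u v → Walk G Q u v
Walk-map P⇒Q (here Pv)         = here (P⇒Q Pv)
Walk-map P⇒Q (step Pu uw rest) = step (P⇒Q Pu) uw (Walk-map P⇒Q rest)

module _ (G : Graph) (X : Subset (n G)) (X-connected : Connected (induced G X))
         (p : Fin (n G) → ℕ) (p-injective : Injective _≡_ _≡_ p)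
         {_≺_ : ℕ → ℕ → Set} (≺-cmp : Trichotomous _≡_ _≺_)
         {w : Fin (n G)} (w∉X : w ∉ X) (w-uncovered : Uncovered G _≺_ p w) where

  walk-in-X-avoids-crossing-w : ∀ {i j} → Walk (induced G X) (λ _ → ⊤) i j →
                                p (embed X i) ≺ p w → p w ≺ p (embed X j) → ⊥
  walk-in-X-avoids-crossing-w (here _) i≺w w≺j = tri⇒asym ≺-cmp i≺w w≺j
  walk-in-X-avoids-crossing-w (step {w = k} _ ik rest) i≺w w≺j with ≺-cmp (p (embed X k)) (p w)
  ... | tri< k≺w _ _ = walk-in-X-avoids-crossing-w rest k≺w w≺j
  ... | tri≈ _ k≡w _ = w∉X (subst (_∈ X) (p-injective k≡w) (embed-∈ X k))
  ... | tri> _ _ w≺k = w-uncovered ik i≺w w≺k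

  walk-into-X-passes-w : ∀ {v x} → Walk G (λ _ → ⊤) v x → v ∉ X → x ∈ X →
                         p v ≺ p w → p w ≺ p x → Walk G (_∉ X) v w
  walk-into-X-passes-w (here _) v∉X x∈X _ _ = ⊥-elim (v∉X x∈X)
  walk-into-X-passes-w (step {w = u} _ vu rest) v∉X x∈X v≺w w≺x with ≺-cmp (p u) (p w)
  ... | tri≈ _ pu≡pw _ with refl ← p-injective pu≡pw = step v∉X vu (here w∉X)
  ... | tri> _ _ w≺u = ⊥-elim (w-uncovered vu v≺w w≺u)
  ... | tri< u≺w _ _ with u ∈? X
  ...   | no u∉X = step v∉X vu (walk-into-X-passes-w rest u∉X x∈X u≺w w≺x)
  ...   | yes u∈X with i , refl ← ∈⇒embed u∈X | j , refl ← ∈⇒embed x∈X =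
    ⊥-elim (walk-in-X-avoids-crossing-w (X-connected i j) u≺w w≺x)

module _ {G : Graph} {X : Subset (n G)} {r : ℕ} {comp : (v : Fin (n G)) → v ∉ X → Fin r}
         (labelling : IsComponentLabelling G X r comp) where

  walk⇒same-label : ∀ {u v} (u∉X : u ∉ X) (v∉X : v ∉ X) → Walk G (_∉ X) u v → comp u u∉X ≡ comp v v∉X
  walk⇒same-label {u} {v} u∉X v∉X = proj₂ (proj₂ labelling u v u∉X v∉X)

  label-irrelevant : ∀ {w} (h h′ : w ∉ X) → comp w h ≡ comp w h′
  label-irrelevant h h′ = walk⇒same-label h h′ (here h)

  two-labels⇒X-nonempty : Connected G → ∀ (i j : Fin r) → i ≢ j → ∃ λ x → x ∈ X
  two-labels⇒X-nonempty G-connected i j i≢j with nonempty? X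
  ... | yes X-nonempty = X-nonempty
  ... | no X-empty with vᵢ , vᵢ∉X , refl ← proj₁ labelling i | vⱼ , vⱼ∉X , refl ← proj₁ labelling j =
    ⊥-elim (i≢j (walk⇒same-label vᵢ∉X vⱼ∉X
      (Walk-map (λ {x} _ x∈X → X-empty (x , x∈X)) (G-connected vᵢ vⱼ))))

module _ (G : Graph) (G-connected : Connected G) (X : Subset (n G)) (X-connected : Connected (induced G X))
         {r : ℕ} {comp : (v : Fin (n G)) → v ∉ X → Fin r} (labelling : IsComponentLabelling G X r comp)
         (p : Fin (n G) → ℕ) (p-injective : Injective _≡_ _≡_ p)
         {x₀ : Fin (n G)} (x₀∈X : x₀ ∈ X) where

  private
    LabelsOnSide : (ℕ → ℕ → Set) → Fin r → Set
    LabelsOnSide _≺_ d = ∀ w (w∉X : w ∉ X) → load G p w ≡ 0 → p w ≺ p x₀ → comp w w∉X ≡ d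

    one-label-on-side : ∀ {_≺_} → Trichotomous _≡_ _≺_ → (∀ {w} → load G p w ≡ 0 → Uncovered G _≺_ p w) →
                        Fin r → Σ (Fin r) (LabelsOnSide _≺_)
    one-label-on-side {_≺_} ≺-cmp uncovered default
      with Finₚ.any? (λ w → ¬? (w ∈? X) ×-dec load G p w ≟ 0 ×-dec tri⇒dec< ≺-cmp (p w) (p x₀))
    ... | no none = default , λ w w∉X load≡0 w≺x₀ → ⊥-elim (none (w , w∉X , load≡0 , w≺x₀))
    ... | yes (w₁ , w₁∉X , load₁≡0 , w₁≺x₀) = comp w₁ w₁∉X , same-as-w₁
      where
      same-label : ∀ {a b} (a∉X : a ∉ X) (b∉X : b ∉ X) → load G p b ≡ 0 →
                   p a ≺ p b → p b ≺ p x₀ → comp a a∉X ≡ comp b b∉X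
      same-label a∉X b∉X load-b≡0 a≺b b≺x₀ = walk⇒same-label labelling a∉X b∉X
        (walk-into-X-passes-w G X X-connected p p-injective ≺-cmp b∉X (uncovered load-b≡0)
          (G-connected _ x₀) a∉X x₀∈X a≺b b≺x₀)
      same-as-w₁ : LabelsOnSide _≺_ (comp w₁ w₁∉X)
      same-as-w₁ w w∉X load≡0 w≺x₀ with ≺-cmp (p w) (p w₁)
      ... | tri< w≺w₁ _ _ = same-label w∉X w₁∉X load₁≡0 w≺w₁ w₁≺x₀
      ... | tri≈ _ pw≡pw₁ _ with refl ← p-injective pw≡pw₁ = label-irrelevant labelling w∉X w₁∉X
      ... | tri> _ _ w₁≺w = sym (same-label w₁∉X w∉X load≡0 w₁≺w w≺x₀)

  uncovered-outside-has-two-labels : Fin r → ∃₂ λ d₁ d₂ →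
    ∀ w (w∉X : w ∉ X) → load G p w ≡ 0 → comp w w∉X ≡ d₁ ⊎ comp w w∉X ≡ d₂
  uncovered-outside-has-two-labels default = d₁ , d₂ , on-either-side
    where
    left : Σ (Fin r) (LabelsOnSide _<_)
    left = one-label-on-side <-cmp (load≡0⇒uncovered G p) default
    right : Σ (Fin r) (LabelsOnSide _>_)
    right = one-label-on-side (IsStrictTotalOrder.compare (Flip.isStrictTotalOrder <-isStrictTotalOrder))
                              (uncovered-flip G p ∘ load≡0⇒uncovered G p) default
    d₁ d₂ : Fin r
    d₁ = proj₁ left
    d₂ = proj₁ right
    on-either-side : ∀ w (w∉X : w ∉ X) → load G p w ≡ 0 → comp w w∉X ≡ d₁ ⊎ comp w w∉X ≡ d₂
    on-either-side w w∉X load≡0 with <-cmp (p w) (p x₀)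
    ... | tri< w<x₀ _ _ = inj₁ (proj₂ left w w∉X load≡0 w<x₀)
    ... | tri≈ _ pw≡px₀ _ = ⊥-elim (w∉X (subst (_∈ X) (sym (p-injective pw≡px₀)) x₀∈X))
    ... | tri> _ _ x₀<w = inj₂ (proj₂ right w w∉X load≡0 x₀<w)

𝟙[_≟_] : ∀ {r} → Fin r → Fin r → ℕ
𝟙[ i ≟ j ] = if ⌊ i ≟ᶠ j ⌋ then 1 else 0

𝟙[≟]-refl : ∀ {r} (i : Fin r) → 𝟙[ i ≟ i ] ≡ 1
𝟙[≟]-refl i with i ≟ᶠ i
... | yes _   = refl
... | no i≢i = ⊥-elim (i≢i refl)

𝟙[≟]-≢ : ∀ {r} {i j : Fin r} → i ≢ j → 𝟙[ i ≟ j ] ≡ 0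
𝟙[≟]-≢ {i = i} {j} i≢j with i ≟ᶠ j
... | yes i≡j = ⊥-elim (i≢j i≡j)
... | no _    = refl

∉⇒lookup≡false : ∀ {N} {X : Subset N} {v} → v ∉ X → lookup X v ≡ false
∉⇒lookup≡false {X = X} {v} v∉X with lookup X v in eq
... | true  = ⊥-elim (v∉X (lookup⇒[]= v X eq))
... | false = refl

module _ (G : Graph) (X : Subset (n G)) (r : ℕ) (comp : (v : Fin (n G)) → v ∉ X → Fin r) where

  private
    N : ℕ
    N = n G

    s : Fin r → ℕ
    s = compSize G X r comp

    inLabel : Fin r → (v : Fin N) → Dec (v ∈ X) → ℕ
    inLabel i v (yes _)  = 0
    inLabel i v (no v∉X) = 𝟙[ comp v v∉X ≟ i ]

    -- The summand of compSize is local to its where block, so summand≡ can name it only by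
    -- unification with its use in s≡∑inLabel, which is therefore checked first.
    summand≡ : ∀ i v → _ ≡ inLabel i v (v ∈? X)

    s≡∑inLabel : ∀ i → s i ≡ sumFin N (λ v → inLabel i v (v ∈? X))
    s≡∑inLabel i = sumFin-cong N (summand≡ i)

    summand≡ i v with v ∈? X
    ... | yes _ = refl
    ... | no _  = refl

  ∑compSize≤ : (ℓ : Fin N → ℕ) (d₁ d₂ : Fin r) →
               (∀ w (w∉X : w ∉ X) → ℓ w ≡ 0 → comp w w∉X ≡ d₁ ⊎ comp w w∉X ≡ d₂) →
               sumFin r s ≤ sumFin N (outside X ℓ) + (s d₁ + s d₂)
  ∑compSize≤ ℓ d₁ d₂ labels-of-zeros = begin
    sumFin r s
      ≡⟨ sumFin-cong r s≡∑inLabel ⟩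
    sumFin r (λ i → sumFin N (λ v → inLabel i v (v ∈? X)))
      ≡⟨ sumFin-comm r N _ ⟩
    sumFin N (λ v → sumFin r (λ i → inLabel i v (v ∈? X)))
      ≤⟨ sumFin-mono-≤ N (λ v → pointwise v (v ∈? X)) ⟩
    sumFin N (λ v → outside X ℓ v + (inLabel d₁ v (v ∈? X) + inLabel d₂ v (v ∈? X)))
      ≡⟨ sumFin-distrib-+ N _ _ ⟩
    sumFin N (outside X ℓ) + sumFin N (λ v → inLabel d₁ v (v ∈? X) + inLabel d₂ v (v ∈? X))
      ≡⟨ cong (sumFin N (outside X ℓ) +_) (sumFin-distrib-+ N _ _) ⟩
    sumFin N (outside X ℓ) + (sumFin N (λ v → inLabel d₁ v (v ∈? X)) + sumFin N (λ v → inLabel d₂ v (v ∈? X)))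
      ≡⟨ cong (sumFin N (outside X ℓ) +_) (cong₂ _+_ (s≡∑inLabel d₁) (s≡∑inLabel d₂)) ⟨
    sumFin N (outside X ℓ) + (s d₁ + s d₂) ∎
    where
    open ≤-Reasoning
    pointwise : ∀ v (v∈?X : Dec (v ∈ X)) →
                sumFin r (λ i → inLabel i v v∈?X) ≤ outside X ℓ v + (inLabel d₁ v v∈?X + inLabel d₂ v v∈?X)
    pointwise v (yes _)  = ≤-trans (≤-reflexive (sumFin-zeros r)) z≤n
    pointwise v (no v∉X) rewrite sumFin-single r (comp v v∉X) (λ i i≢c → 𝟙[≟]-≢ (i≢c ∘ sym))
                               | 𝟙[≟]-refl (comp v v∉X) | ∉⇒lookup≡false v∉X
      with ℓ v ≟ 0
    ... | no ℓv≢0 = ≤-trans (n≢0⇒n>0 ℓv≢0) (m≤m+n (ℓ v) _)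
    ... | yes ℓv≡0 with labels-of-zeros v v∉X ℓv≡0
    ...   | inj₁ refl rewrite 𝟙[≟]-refl d₁ = ≤-trans (m≤m+n 1 _) (m≤n+m _ (ℓ v))
    ...   | inj₂ refl rewrite 𝟙[≟]-refl d₂ = ≤-trans (m≤n+m 1 _) (m≤n+m _ (ℓ v))

sumFin≡sumButTwoLast+lastTwo : ∀ q (s : Fin (suc (suc q)) → ℕ) →
  sumFin (suc (suc q)) s ≡ sumButTwoLast (suc (suc q)) s + (s (inject₁ (fromℕ q)) + s (fromℕ (suc q)))
sumFin≡sumButTwoLast+lastTwo zero    s = cong (s fz +_) (+-identityʳ (s (fs fz)))
sumFin≡sumButTwoLast+lastTwo (suc q) s = begin
  s fz + sumFin (suc (suc q)) (s ∘ fs)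
    ≡⟨ cong (s fz +_) (sumFin≡sumButTwoLast+lastTwo q (s ∘ fs)) ⟩
  s fz + (sumButTwoLast (suc (suc q)) (s ∘ fs) + (s (fs (inject₁ (fromℕ q))) + s (fs (fromℕ (suc q)))))
    ≡⟨ +-assoc (s fz) _ _ ⟨
  s fz + sumButTwoLast (suc (suc q)) (s ∘ fs) + (s (fs (inject₁ (fromℕ q))) + s (fs (fromℕ (suc q)))) ∎
  where open ≡-Reasoning

sumButTwoLast+≤sumFin : ∀ r (s : Fin r → ℕ) → (∀ i j → i Data.Fin.≤ j → s i ≤ s j) →
                        ∀ {d₁ d₂} → d₁ ≢ d₂ → sumButTwoLast r s + (s d₁ + s d₂) ≤ sumFin r s
sumButTwoLast+≤sumFin (suc zero)    s s-mono {fz} {fz} d₁≢d₂ = ⊥-elim (d₁≢d₂ refl)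
sumButTwoLast+≤sumFin (suc (suc q)) s s-mono {d₁} {d₂} d₁≢d₂ = begin
  sumButTwoLast (suc (suc q)) s + (s d₁ + s d₂)
    ≤⟨ +-monoʳ-≤ (sumButTwoLast (suc (suc q)) s) d₁+d₂≤lastTwo ⟩
  sumButTwoLast (suc (suc q)) s + (s (inject₁ (fromℕ q)) + s (fromℕ (suc q)))
    ≡⟨ sumFin≡sumButTwoLast+lastTwo q s ⟨
  sumFin (suc (suc q)) s ∎
  where
  open ≤-Reasoning
  ordered≤lastTwo : ∀ i j → toℕ i < toℕ j → s i + s j ≤ s (inject₁ (fromℕ q)) + s (fromℕ (suc q))
  ordered≤lastTwo i j i<j = +-mono-≤ (s-mono i _ i≤q) (s-mono j _ (Finₚ.≤fromℕ j))
    where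
    i≤q : toℕ i ≤ toℕ (inject₁ (fromℕ q))
    i≤q rewrite Finₚ.toℕ-inject₁ (fromℕ q) | Finₚ.toℕ-fromℕ q =
      s≤s⁻¹ (≤-trans i<j (s≤s⁻¹ (Finₚ.toℕ<n j)))
  d₁+d₂≤lastTwo : s d₁ + s d₂ ≤ s (inject₁ (fromℕ q)) + s (fromℕ (suc q))
  d₁+d₂≤lastTwo with <-cmp (toℕ d₁) (toℕ d₂)
  ... | tri< d₁<d₂ _ _ = ordered≤lastTwo d₁ d₂ d₁<d₂
  ... | tri≈ _ d₁≡d₂ _ = ⊥-elim (d₁≢d₂ (toℕ-injective d₁≡d₂))
  ... | tri> _ _ d₂<d₁ = ≤-trans (≤-reflexive (+-comm (s d₁) (s d₂))) (ordered≤lastTwo d₂ d₁ d₂<d₁)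

distinct-pair-covering : ∀ {q} (d₁ d₂ : Fin (suc (suc q))) → ∃₂ λ e₁ e₂ →
  e₁ ≢ e₂ × (∀ {k} → k ≡ d₁ ⊎ k ≡ d₂ → k ≡ e₁ ⊎ k ≡ e₂)
distinct-pair-covering d₁ d₂ with d₁ ≟ᶠ d₂
... | no d₁≢d₂ = d₁ , d₂ , d₁≢d₂ , λ k∈d → k∈d
... | yes refl = d₁ , another d₁ , another-≢ d₁ , [ inj₁ , inj₁ ]′
  where
  another : ∀ {q} → Fin (suc (suc q)) → Fin (suc (suc q))
  another fz     = fs fz
  another (fs _) = fz
  another-≢ : ∀ {q} (i : Fin (suc (suc q))) → i ≢ another i
  another-≢ fz     ()
  another-≢ (fs _) ()

sumButTwoLast≤∑outside-load : (G : Graph) → Connected G → (X : Subset (n G)) → Connected (induced G X) →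
  ∀ r {comp} → IsComponentLabelling G X r comp →
  (∀ (i j : Fin r) → i Data.Fin.≤ j → compSize G X r comp i ≤ compSize G X r comp j) →
  ∀ p → Injective _≡_ _≡_ p → sumButTwoLast r (compSize G X r comp) ≤ sumFin (n G) (outside X (load G p))
sumButTwoLast≤∑outside-load G G-connected X X-connected zero          labelling sizes-mono p p-injective = z≤n
sumButTwoLast≤∑outside-load G G-connected X X-connected (suc zero)    labelling sizes-mono p p-injective = z≤n
sumButTwoLast≤∑outside-load G G-connected X X-connected (suc (suc q)) {comp} labelling sizes-mono p p-injective =
  let _ , x₀∈X              = two-labels⇒X-nonempty labelling G-connected fz (fs fz) (λ ())
      d₁ , d₂ , cover         = uncovered-outside-has-two-labels G G-connected X X-connected labelling
                                                                 p p-injective x₀∈X fz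
      e₁ , e₂ , e₁≢e₂ , widen = distinct-pair-covering d₁ d₂
  in +-cancelʳ-≤ (s e₁ + s e₂) _ _ (≤-trans
       (sumButTwoLast+≤sumFin r s sizes-mono e₁≢e₂)
       (∑compSize≤ G X r comp (load G p) e₁ e₂ (λ w w∉X load≡0 → widen (cover w w∉X load≡0))))
  where
  r : ℕ
  r = suc (suc q)
  s : Fin r → ℕ
  s = compSize G X r comp

lemma2p6 : (G : Graph) → Connected G → (X : Subset (n G)) → Connected (induced G X)
    → (r : ℕ) (comp : (v : Fin (n G)) → v ∉ X → Fin r)
    → IsComponentLabelling G X r comp
    → (∀ (i j : Fin r) → i Data.Fin.≤ j → compSize G X r comp i ≤ compSize G X r comp j)
    → (m m' : ℕ) → IsOla⁺ G m → IsOla⁺ (induced G X) m'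
    → m' + sumButTwoLast r (compSize G X r comp) ≤ m
lemma2p6 G G-connected X X-connected r comp labelling sizes-mono m m'
         (((α , α-bij) , cost≡m) , _) (_ , m'-minimal) = begin
  m' + sumButTwoLast r (compSize G X r comp)
    ≤⟨ +-mono-≤ (≤-trans (m'-minimal (rankFin , rankFin-bijective)) induced-cost≤)
                (sumButTwoLast≤∑outside-load G G-connected X X-connected r labelling sizes-mono p p-injective) ⟩
  sumFin (card X) (λ k → load G p (embed X k)) + sumFin (n G) (outside X (load G p))
    ≡⟨ sumFin-split-embed X (load G p) ⟨
  sumFin (n G) (load G p)
    ≤⟨ ∑load≤netCost G α-bij ⟩
  netCost G α
    ≡⟨ cost≡m ⟩
  m ∎
  where
  open ≤-Reasoning
  p : Fin (n G) → ℕ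
  p u = toℕ (α u)
  p-injective : Injective _≡_ _≡_ p
  p-injective = proj₁ α-bij ∘ toℕ-injective
  c : Fin (card X) → ℕ
  c k = p (embed X k)
  c-injective : Injective _≡_ _≡_ c
  c-injective = embed-injective X ∘ p-injective
  open Rank c c-injective using (rankFin; rankFin-bijective)
  induced-cost≤ : netCost (induced G X) rankFin ≤ sumFin (card X) (λ k → load G p (embed X k))
  induced-cost≤ = ≤-trans (netCost-rankFin≤∑load (induced G X) c-injective)
                          (sumFin-mono-≤ (card X) (load-induced≤ G X p))
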